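{- Let $p\geq 3$ and let $T$ be a tree with $r_p(T)=p+1$ (so $T$ has a unique $\gamma_p(T)$-set, denoted $\mathcal{D}_T$). Let $x\in\mathcal{D}_T$ and $X\subseteq V(T)\setminus\{x\}$ with $|X|<\gamma_p(T)$. If $\mu_p(x,\mathcal{D}_T,T)\geq p+2$ and $\eta_p(V(T),X,T)=p+1$, then $|X\cap V(T_y)|=|\mathcal{D}_T\cap V(T_y)|$ for every $y\in N_T(x)$, where $T_y$ is the component of $T-x$ containing $y$.
   Context: All graphs are finite, simple and undirected. For a graph $G=(V,E)$ and a positive integer $p$, a set $D\subseteq V$ is a $p$-dominating set if every vertex not in $D$ has at least $p$ neighbours in $D$; $\gamma_p(G)$ is the minimum cardinality of a $p$-dominating set, and a $p$-dominating set of this size is a $\gamma_p(G)$-set. The $p$-reinforcement number is $r_p(G)=\min\{|B| : B\subseteq E(G^c),\ \gamma_p(G+B)<\gamma_p(G)\}$, where $G^c$ is the complement and $G+B$ is $G$ with the edges of $B$ added; by convention $r_p(G)=0$ if $\gamma_p(G)\leq p$. For $x\in V$ and $X\subseteq V$, a vertex $y\in V\setminus X$ is a $p$-private neighbour of $x$ with respect to $X$ if $xy\in E$ and $|N_G(y)\cap X|=p$; $PN_p(x,X,G)$ denotes the set of such vertices, and $\mu_p(x,X,G)=|PN_p(x,X,G)|+\max\{0,p-|N_G(x)\cap X|\}$. For $X\subseteq V$ and $x\in V$, define $\eta_p(x,X,G)=p-|N_G(x)\cap X|$ if $x\notin X$ and $|N_G(x)\cap X|<p$, and $\eta_p(x,X,G)=0$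 otherwise; for $S\subseteq V$, $\eta_p(S,X,G)=\sum_{x\in S}\eta_p(x,X,G)$. -}

module Defs where

open import Data.Nat using (ℕ; zero; suc; _+_; _∸_; _≤_; _<_; _≡ᵇ_; _<ᵇ_)
open import Data.Bool using (Bool; true; false; _∨_; _∧_; if_then_else_; not)
open import Data.Bool.Properties using (∨-comm)
open import Data.Fin using (Fin; toℕ)
open import Data.Fin.Subset using (Subset; ∣_∣; _∩_; _∈_; _∉_; _⊆_)
open import Data.Vec using (tabulate; lookup)
open import Data.List using (List; []; _∷_; _++_; [_]; length; map; allFin)
open import Data.Nat.ListAction using (sum)
open import Data.List.Relation.Unary.Unique.Propositional using (Unique)
open import Data.Product using (Σ; ∃; _×_; _,_)
open import Data.Unit using (⊤)
open import Data.Empty using (⊥)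
open import Relation.Nullary using (¬_)
open import Relation.Binary.PropositionalEquality using (_≡_; _≢_; refl; cong₂; trans)

record Graph (n : ℕ) : Set where
  field
    adj   : Fin n → Fin n → Bool
    sym   : ∀ u v → adj u v ≡ adj v u
    irrefl : ∀ v → adj v v ≡ false
open Graph public

module _ {n : ℕ} where

  N : Graph n → Fin n → Subset n
  N G v = tabulate (λ w → adj G v w)

  degIn : Graph n → Fin n → Subset n → ℕ
  degIn G v X = ∣ N G v ∩ X ∣

  sumV : (Fin n → ℕ) → ℕ
  sumV f = sum (map f (allFin n))

  edgeCount : Graph n → ℕ
  edgeCount G = sumV (λ i → ∣ tabulate (λ j → adj G i j ∧ (toℕ i <ᵇ toℕ j)) ∣)

  data Walk (G : Graph n) : Fin n → Fin n → Set where
    here : ∀ {u} → Walk G u u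
    step : ∀ {u w v} → adj G u w ≡ true → Walk G w v → Walk G u v

  data WalkAvoiding (G : Graph n) (x : Fin n) : Fin n → Fin n → Set where
    here : ∀ {u} → u ≢ x → WalkAvoiding G x u u
    step : ∀ {u w v} → u ≢ x → adj G u w ≡ true → WalkAvoiding G x w v → WalkAvoiding G x u v

  Connected : Graph n → Set
  Connected G = ∀ u v → Walk G u v

  Chain : Graph n → List (Fin n) → Set
  Chain G [] = ⊤
  Chain G (v ∷ []) = ⊤
  Chain G (u ∷ w ∷ vs) = (adj G u w ≡ true) × Chain G (w ∷ vs)

  IsCycle : Graph n → Fin n → List (Fin n) → Set
  IsCycle G u vs = (2 ≤ length vs) × Unique (u ∷ vs) × Chain G (u ∷ vs ++ [ u ])

  Acyclic : Graph n → Set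
  Acyclic G = ∀ u vs → ¬ IsCycle G u vs

  IsTree : Graph n → Set
  IsTree G = (1 ≤ n) × Connected G × Acyclic G

  IsComponentMinus : Graph n → Fin n → Fin n → Subset n → Set
  IsComponentMinus G x y C = ∀ v → (v ∈ C → WalkAvoiding G x y v) × (WalkAvoiding G x y v → v ∈ C)

  IsPDom : Graph n → ℕ → Subset n → Set
  IsPDom G p D = ∀ v → v ∉ D → p ≤ degIn G v D

  IsGammaPSet : Graph n → ℕ → Subset n → Set
  IsGammaPSet G p D = IsPDom G p D × (∀ D' → IsPDom G p D' → ∣ D ∣ ≤ ∣ D' ∣)

  IsGammaP : Graph n → ℕ → ℕ → Set
  IsGammaP G p k = Σ (Subset n) λ D → IsGammaPSet G p D × ∣ D ∣ ≡ k

  -- B is a set of edges of the complement of G (represented as a graph)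
  NonEdges : Graph n → Graph n → Set
  NonEdges G B = ∀ u v → adj B u v ≡ true → adj G u v ≡ false

  _⊕_ : Graph n → Graph n → Graph n
  G ⊕ B = record
    { adj = λ u v → adj G u v ∨ adj B u v
    ; sym = λ u v → cong₂ _∨_ (sym G u v) (sym B u v)
    ; irrefl = λ v → trans (cong₂ _∨_ (irrefl G v) (irrefl B v)) refl
    }

  Reinforces : Graph n → ℕ → Graph n → Set
  Reinforces G p B = ∀ γ γ' → IsGammaP G p γ → IsGammaP (G ⊕ B) p γ' → γ' < γ

  -- r_p(G) = r  (with the convention r_p(G) = 0 when γ_p(G) ≤ p)
  IsRP : Graph n → ℕ → ℕ → Set
  IsRP G p r = ∀ γ → IsGammaP G p γ →
      (γ ≤ p → r ≡ 0)
    × (p < γ →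
         (Σ (Graph n) λ B → NonEdges G B × Reinforces G p B × edgeCount B ≡ r)
       × (∀ B → NonEdges G B → Reinforces G p B → r ≤ edgeCount B))

  PN : Graph n → ℕ → Fin n → Subset n → Subset n
  PN G p x X = tabulate (λ y → adj G x y ∧ not (lookup X y) ∧ (degIn G y X ≡ᵇ p))

  μ : Graph n → ℕ → Fin n → Subset n → ℕ
  μ G p x X = ∣ PN G p x X ∣ + (p ∸ degIn G x X)

  η : Graph n → ℕ → Fin n → Subset n → ℕ
  η G p x X = if lookup X x then 0 else (if degIn G x X <ᵇ p then p ∸ degIn G x X else 0)

  ηV : Graph n → ℕ → Subset n → ℕ
  ηV G p X = sumV (λ x → η G p x X)

module Submission where

-- Proof structure.
--  * Finite sums over Fin n, and cardinalities, degrees and deficiencies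
--    η_p written as such sums.
--  * Branches of a tree at a vertex c (the components of T - c): every vertex
--    other than c lies in exactly one, and branches only touch through c.
--  * The reinforcement bound: if r_p(G) = r ≥ 1 and |S| < γ_p(G), then
--    η_p(V, S) ≥ r, because joining each deficient vertex to enough members of
--    S uses η_p(V, S) new edges and makes S a smaller p-dominating set; and
--    η_p(V, S) ≥ r + 1 if even |S| + 1 < γ_p(G).
--  * Splicing two sets along a branch, and the degree changes this causes;
--    with the reinforcement bound this yields uniqueness of the γ_p-set.
--  * The main argument: if some branch at x carried fewer vertices of X than
--    of D, splicing X into D there would absorb the whole deficiency p + 1,
--    every other branch would force X to agree with D or to exceed it, and
--    counting would leave at most two private neighbours of x and at most two
--    neighbours of x in X, contradicting μ_p(x, D) ≥ p + 2 and p ≥ 3.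
--    Since |X| < |D| overall, every branch is then balanced.

open import Defs hiding (sym)
open import Data.Nat using (ℕ; zero; suc; _+_; _∸_; _≤_; _<_; z≤n; s≤s; _<ᵇ_; _≡ᵇ_; _<?_; _≤?_)
open import Data.Nat.Properties hiding (_≟_)
open import Data.Nat.ListAction using (sum)
open import Data.Nat.Solver using (module +-*-Solver)
open import Data.Bool using (Bool; true; false; _∧_; _∨_; not; if_then_else_) renaming (T to IsTrue)
open import Data.Bool.Properties using (∨-comm; ∨-zeroʳ; ∧-zeroʳ; ∧-comm)
open import Data.Fin using (Fin; toℕ; _≟_) renaming (zero to fzero; suc to fsuc)
open import Data.Fin.Subset using (Subset; ∣_∣; _∩_; _∪_; ∁; ⁅_⁆; _∈_; _∉_)
open import Data.Fin.Subset.Properties using (∣p∣≤n; ∣∁p∣≡n∸∣p∣; ∣⁅x⁆∣≡1; x∈⁅y⁆⇒x≡y)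
open import Data.Vec using (Vec; []; _∷_; tabulate; lookup)
open import Data.Vec.Properties using (lookup∘tabulate; lookup-zipWith; lookup-map; []=⇒lookup; lookup⇒[]=)
open import Data.List using (List; []; _∷_; _++_; [_]; map)
import Data.List as List
open import Data.List.Relation.Unary.All using (All; []; _∷_) renaming (map to All-map)
open import Data.List.Relation.Unary.All.Properties.Core using (¬Any⇒All¬)
open import Data.List.Relation.Unary.AllPairs using ([]; _∷_)
open import Data.List.Relation.Unary.Any using (Any; here; there)
open import Data.List.Relation.Unary.Unique.Propositional using (Unique)
open import Data.Product using (Σ; ∃; _×_; _,_; proj₁; proj₂)
open import Data.Sum using (_⊎_; inj₁; inj₂)
open import Data.Unit using (tt)
open import Data.Empty using (⊥; ⊥-elim)
open import Relation.Nullary using (¬_; yes; no; does; Dec; contradiction)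
open import Relation.Nullary.Decidable using (dec-true; dec-false)
open import Relation.Binary.PropositionalEquality hiding ([_])
open +-*-Solver using (solve; _:+_; _:=_)


_==_ : {n : ℕ} → Fin n → Fin n → Bool
i == j = does (i ≟ j)

==-refl : {n : ℕ} (i : Fin n) → (i == i) ≡ true
==-refl i = dec-true (i ≟ i) refl

==-≢ : {n : ℕ} {i j : Fin n} → i ≢ j → (i == j) ≡ false
==-≢ {i = i} {j} = dec-false (i ≟ j)

-- Case analysis on a Boolean that keeps the Boolean unabstracted in the goal.
by-cases : ∀ {ℓ} {P : Set ℓ} (b : Bool) → (b ≡ true → P) → (b ≡ false → P) → P
by-cases true t f = t refl
by-cases false t f = f refl

when : Bool → ℕ → ℕ
when true m = m
when false m = 0

𝟙 : Bool → ℕ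
𝟙 b = when b 1

𝟙≤1 : ∀ b → 𝟙 b ≤ 1
𝟙≤1 true = ≤-refl
𝟙≤1 false = z≤n

𝟙-∧≤ : ∀ a b → 𝟙 (a ∧ b) ≤ 𝟙 a
𝟙-∧≤ true b = 𝟙≤1 b
𝟙-∧≤ false b = z≤n

when-∧ : ∀ a b m → when (a ∧ b) m ≡ when a (when b m)
when-∧ true b m = refl
when-∧ false b m = refl

when-𝟙 : ∀ a b → when a (𝟙 b) ≡ 𝟙 (a ∧ b)
when-𝟙 true b = refl
when-𝟙 false b = refl

when-< : ∀ b {x y} → when b x < when b y → (b ≡ true) × (x < y)
when-< true lt = refl , lt
when-< false ()

∑ : (n : ℕ) → (Fin n → ℕ) → ℕ
∑ zero f = 0
∑ (suc n) f = f fzero + ∑ n (λ i → f (fsuc i))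

sumV≡∑ : ∀ {n} (f : Fin n → ℕ) → sumV f ≡ ∑ n f
sumV≡∑ {n} f = sum-map-tabulate n (λ i → i)
  where
  sum-map-tabulate : ∀ m (g : Fin m → Fin n) → sum (map f (List.tabulate g)) ≡ ∑ m (λ i → f (g i))
  sum-map-tabulate zero g = refl
  sum-map-tabulate (suc m) g = cong (f (g fzero) +_) (sum-map-tabulate m (λ i → g (fsuc i)))

∑-cong : ∀ n {f g : Fin n → ℕ} → (∀ i → f i ≡ g i) → ∑ n f ≡ ∑ n g
∑-cong zero e = refl
∑-cong (suc n) e = cong₂ _+_ (e fzero) (∑-cong n (λ i → e (fsuc i)))

∑-mono : ∀ n {f g : Fin n → ℕ} → (∀ i → f i ≤ g i) → ∑ n f ≤ ∑ n g
∑-mono zero e = z≤n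
∑-mono (suc n) e = +-mono-≤ (e fzero) (∑-mono n (λ i → e (fsuc i)))

∑-+ : ∀ n (f g : Fin n → ℕ) → ∑ n (λ i → f i + g i) ≡ ∑ n f + ∑ n g
∑-+ zero f g = refl
∑-+ (suc n) f g =
  trans (cong (f fzero + g fzero +_) (∑-+ n (λ i → f (fsuc i)) (λ i → g (fsuc i))))
        (solve 4 (λ a b c d → a :+ b :+ (c :+ d) := a :+ c :+ (b :+ d)) refl
               (f fzero) (g fzero) (∑ n (λ i → f (fsuc i))) (∑ n (λ i → g (fsuc i))))

∑-zero : ∀ n {f : Fin n → ℕ} → (∀ i → f i ≡ 0) → ∑ n f ≡ 0
∑-zero zero e = refl
∑-zero (suc n) e = cong₂ _+_ (e fzero) (∑-zero n (λ i → e (fsuc i)))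

∑-term : ∀ n (f : Fin n → ℕ) i → f i ≤ ∑ n f
∑-term (suc n) f fzero = m≤m+n (f fzero) _
∑-term (suc n) f (fsuc i) = ≤-trans (∑-term n (λ j → f (fsuc j)) i) (m≤n+m _ (f fzero))

∑-< : ∀ n (f g : Fin n → ℕ) → ∑ n f < ∑ n g → ∃ λ i → f i < g i
∑-< (suc n) f g h with f fzero <? g fzero
... | yes lt = fzero , lt
... | no ≮ with ∑-< n (λ i → f (fsuc i)) (λ i → g (fsuc i))
                  (+-cancelˡ-< (g fzero) _ _ (≤-<-trans (+-monoˡ-≤ _ (≮⇒≥ ≮)) h))
...   | i , lt = fsuc i , lt

∑-≤-rigid : ∀ n (f g : Fin n → ℕ) → (∀ i → g i ≤ f i) → ∑ n f ≤ ∑ n g → ∀ i → f i ≡ g i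
∑-≤-rigid (suc n) f g g≤f le fzero =
  ≤-antisym (+-cancelʳ-≤ _ (f fzero) (g fzero)
              (≤-trans le (+-monoʳ-≤ (g fzero) (∑-mono n (λ i → g≤f (fsuc i))))))
            (g≤f fzero)
∑-≤-rigid (suc n) f g g≤f le (fsuc i) =
  ∑-≤-rigid n (λ i → f (fsuc i)) (λ i → g (fsuc i)) (λ i → g≤f (fsuc i))
    (+-cancelˡ-≤ (f fzero) _ _ (≤-trans le (+-monoˡ-≤ _ (g≤f fzero)))) i

∑-point : ∀ n (i : Fin n) (f : Fin n → ℕ) → ∑ n (λ j → when (j == i) (f j)) ≡ f i
∑-point (suc n) fzero f = trans (cong (f fzero +_) (∑-zero n (λ _ → refl))) (+-identityʳ _)
∑-point (suc n) (fsuc i) f = ∑-point n i (λ j → f (fsuc j))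

∑-𝟙-point : ∀ n (i : Fin n) → ∑ n (λ j → 𝟙 (j == i)) ≡ 1
∑-𝟙-point n i = ∑-point n i (λ _ → 1)

∑-split : ∀ n (i : Fin n) (f : Fin n → ℕ) → ∑ n f ≡ f i + ∑ n (λ j → when (not (j == i)) (f j))
∑-split n i f = begin
    ∑ n f
  ≡⟨ ∑-cong n (λ j → split (j == i) (f j)) ⟩
    ∑ n (λ j → when (j == i) (f j) + when (not (j == i)) (f j))
  ≡⟨ ∑-+ n _ _ ⟩
    ∑ n (λ j → when (j == i) (f j)) + ∑ n (λ j → when (not (j == i)) (f j))
  ≡⟨ cong (_+ ∑ n (λ j → when (not (j == i)) (f j))) (∑-point n i f) ⟩
    f i + ∑ n (λ j → when (not (j == i)) (f j))
  ∎
  where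
  open ≡-Reasoning
  split : ∀ b m → m ≡ when b m + when (not b) m
  split true m = sym (+-identityʳ m)
  split false m = refl

∑-swap : ∀ n m (f : Fin n → Fin m → ℕ) → ∑ n (λ i → ∑ m (f i)) ≡ ∑ m (λ j → ∑ n (λ i → f i j))
∑-swap zero m f = sym (∑-zero m (λ _ → refl))
∑-swap (suc n) m f =
  trans (cong (∑ m (f fzero) +_) (∑-swap n m (λ i → f (fsuc i))))
        (sym (∑-+ m (f fzero) (λ j → ∑ n (λ i → f (fsuc i) j))))

when-∑ : ∀ n b (h : Fin n → ℕ) → when b (∑ n h) ≡ ∑ n (λ w → when b (h w))
when-∑ n true h = refl
when-∑ n false h = sym (∑-zero n (λ _ → refl))

exchange-< : ∀ a b c d k → a + b ≡ c + d → c + k < b → a + k < d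
exchange-< a b c d k a+b≡c+d c+k<b = +-cancelʳ-< b (a + k) d (begin-strict
    a + k + b
  ≡⟨ solve 3 (λ a b k → a :+ k :+ b := a :+ b :+ k) refl a b k ⟩
    a + b + k
  ≡⟨ cong (_+ k) a+b≡c+d ⟩
    c + d + k
  ≡⟨ solve 3 (λ c d k → c :+ d :+ k := c :+ k :+ d) refl c d k ⟩
    c + k + d
  <⟨ +-monoˡ-< d c+k<b ⟩
    b + d
  ≡⟨ +-comm b d ⟩
    d + b
  ∎)
  where open ≤-Reasoning

squeeze : ∀ a b c k → a + (b + c) ≡ k → k ≤ b → (a ≡ 0) × (c ≡ 0)
squeeze a b c k a+[b+c]≡k k≤b = m+n≡0⇒m≡0 a a+c≡0 , m+n≡0⇒n≡0 a a+c≡0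
  where
  a+c≡0 : a + c ≡ 0
  a+c≡0 = n≤0⇒n≡0 (+-cancelʳ-≤ b (a + c) 0
    (subst (_≤ b) (sym (trans (solve 3 (λ a b c → a :+ c :+ b := a :+ (b :+ c)) refl a b c) a+[b+c]≡k)) k≤b))

∸-lossless : ∀ p d → 1 ≤ p → p ≤ p ∸ d → d ≡ 0
∸-lossless p zero _ _ = refl
∸-lossless (suc q) (suc d) _ q<q = contradiction (≤-trans q<q (m∸n≤m q d)) (<-irrefl refl)

3≰2 : ¬ 3 ≤ 2
3≰2 (s≤s (s≤s ()))

∉⇒lookup : ∀ {n} (X : Subset n) v → v ∉ X → lookup X v ≡ false
∉⇒lookup X v v∉X with lookup X v in e
... | true = ⊥-elim (v∉X (lookup⇒[]= v X e))
... | false = refl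

lookup⇒∉ : ∀ {n} (X : Subset n) v → lookup X v ≡ false → v ∉ X
lookup⇒∉ X v e v∈X with trans (sym ([]=⇒lookup v∈X)) e
... | ()

_⊑_ : ∀ {n} → Subset n → Subset n → Set
A ⊑ B = ∀ i → lookup A i ≡ true → lookup B i ≡ true

module _ {n : ℕ} where

  card-∑ : (X : Subset n) → ∣ X ∣ ≡ ∑ n (λ w → 𝟙 (lookup X w))
  card-∑ = go
    where
    go : ∀ {m} (v : Vec Bool m) → ∣ v ∣ ≡ ∑ m (λ i → 𝟙 (lookup v i))
    go [] = refl
    go (true ∷ v) = cong suc (go v)
    go (false ∷ v) = go v

  card-tabulate : (f : Fin n → Bool) → ∣ tabulate f ∣ ≡ ∑ n (λ w → 𝟙 (f w))
  card-tabulate f = trans (card-∑ (tabulate f)) (∑-cong n (λ w → cong 𝟙 (lookup∘tabulate f w)))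

  degIn-∑ : (G : Graph n) (v : Fin n) (X : Subset n) → degIn G v X ≡ ∑ n (λ w → 𝟙 (adj G v w ∧ lookup X w))
  degIn-∑ G v X = trans (card-∑ (N G v ∩ X)) (∑-cong n λ w → cong 𝟙
    (trans (lookup-zipWith _∧_ w (N G v) X) (cong (_∧ lookup X w) (lookup∘tabulate (adj G v) w))))

  η-when : (G : Graph n) (p : ℕ) (w : Fin n) (X : Subset n) →
           η G p w X ≡ when (not (lookup X w)) (p ∸ degIn G w X)
  η-when G p w X with lookup X w
  ... | true = refl
  ... | false with degIn G w X <ᵇ p in lt
  ...   | true = refl
  ...   | false = sym (m≤n⇒m∸n≡0 {p} {degIn G w X} (≮⇒≥ (λ d<p → subst IsTrue lt (<⇒<ᵇ d<p))))

  ηV-∑ : (G : Graph n) (p : ℕ) (X : Subset n) → ηV G p X ≡ ∑ n (λ w → η G p w X)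
  ηV-∑ G p X = sumV≡∑ (λ w → η G p w X)

  η-member : (G : Graph n) (p : ℕ) (w : Fin n) (X : Subset n) → lookup X w ≡ true → η G p w X ≡ 0
  η-member G p w X e rewrite η-when G p w X | e = refl

  η-outside : (G : Graph n) (p : ℕ) (w : Fin n) (X : Subset n) → lookup X w ≡ false →
              η G p w X ≡ p ∸ degIn G w X
  η-outside G p w X e rewrite η-when G p w X | e = refl

  η-≤ : (G : Graph n) (p : ℕ) (w : Fin n) (X : Subset n) (k : ℕ) →
        lookup X w ≡ false → p ≤ degIn G w X + k → η G p w X ≤ k
  η-≤ G p w X k e h rewrite η-outside G p w X e =
    subst (p ∸ degIn G w X ≤_) (m+n∸m≡n (degIn G w X) k) (∸-monoˡ-≤ (degIn G w X) h)

  degIn-≤ : (G : Graph n) (w : Fin n) (A B : Subset n) (h : Fin n → ℕ) →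
            (∀ t → 𝟙 (adj G w t ∧ lookup A t) ≤ 𝟙 (adj G w t ∧ lookup B t) + h t) →
            degIn G w A ≤ degIn G w B + ∑ n h
  degIn-≤ G w A B h pt =
    subst₂ _≤_ (sym (degIn-∑ G w A)) (trans (∑-+ n _ _) (cong (_+ ∑ n h) (sym (degIn-∑ G w B))))
           (∑-mono n pt)

  degIn-mono : (G : Graph n) (v : Fin n) (A B : Subset n) → A ⊑ B → degIn G v A ≤ degIn G v B
  degIn-mono G v A B A⊑B =
    subst₂ _≤_ (sym (degIn-∑ G v A)) (sym (degIn-∑ G v B)) (∑-mono n pt)
    where
    pt : ∀ t → 𝟙 (adj G v t ∧ lookup A t) ≤ 𝟙 (adj G v t ∧ lookup B t)
    pt t with adj G v t | lookup A t in e
    ... | false | _ = z≤n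
    ... | true | false = z≤n
    ... | true | true rewrite A⊑B t e = ≤-refl

  η-antitone : (G : Graph n) (p : ℕ) (w : Fin n) (A B : Subset n) → A ⊑ B → η G p w B ≤ η G p w A
  η-antitone G p w A B A⊑B = by-cases (lookup B w) inB outB
    where
    inB : lookup B w ≡ true → η G p w B ≤ η G p w A
    inB eB = subst (_≤ η G p w A) (sym (η-member G p w B eB)) z≤n
    outB : lookup B w ≡ false → η G p w B ≤ η G p w A
    outB eB = subst₂ _≤_ (sym (η-outside G p w B eB)) (sym (η-outside G p w A eA))
                         (∸-monoʳ-≤ p (degIn-mono G w A B A⊑B))
      where
      eA : lookup A w ≡ false
      eA = by-cases (lookup A w) (λ eA → contradiction (trans (sym (A⊑B w eA)) eB) λ ()) (λ eA → eA)

  ηV-antitone : (G : Graph n) (p : ℕ) (A B : Subset n) → A ⊑ B → ηV G p B ≤ ηV G p A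
  ηV-antitone G p A B A⊑B =
    subst₂ _≤_ (sym (ηV-∑ G p B)) (sym (ηV-∑ G p A)) (∑-mono n (λ w → η-antitone G p w A B A⊑B))

  ηV-zero⇒pdom : (G : Graph n) (p : ℕ) (X : Subset n) → ηV G p X ≡ 0 → IsPDom G p X
  ηV-zero⇒pdom G p X ηV≡0 v v∉X = m∸n≡0⇒m≤n (trans (sym (η-outside G p v X (∉⇒lookup X v v∉X))) ηv≡0)
    where
    ηv≡0 : η G p v X ≡ 0
    ηv≡0 = n≤0⇒n≡0 (subst (η G p v X ≤_) (trans (sym (ηV-∑ G p X)) ηV≡0) (∑-term n (λ w → η G p w X) v))

  pdom⇒η≡0 : (G : Graph n) (p : ℕ) (X : Subset n) → IsPDom G p X → ∀ w → η G p w X ≡ 0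
  pdom⇒η≡0 G p X pdX w = by-cases (lookup X w) (η-member G p w X)
    (λ e → trans (η-outside G p w X e) (m≤n⇒m∸n≡0 (pdX w (lookup⇒∉ X w e))))

  γ-unique : (G : Graph n) (p γ₁ γ₂ : ℕ) → IsGammaP G p γ₁ → IsGammaP G p γ₂ → γ₁ ≡ γ₂
  γ-unique G p γ₁ γ₂ (D₁ , (pd₁ , min₁) , e₁) (D₂ , (pd₂ , min₂) , e₂) =
    ≤-antisym (subst₂ _≤_ e₁ e₂ (min₁ D₂ pd₂)) (subst₂ _≤_ e₂ e₁ (min₂ D₁ pd₁))

  γ-≤ : (G : Graph n) (p γ : ℕ) → IsGammaP G p γ → (X : Subset n) → IsPDom G p X → γ ≤ ∣ X ∣
  γ-≤ G p γ (D , (_ , min) , e) X pdX = subst (_≤ ∣ X ∣) e (min X pdX)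

  γSet-size : (G : Graph n) (p γ : ℕ) → IsGammaP G p γ → (D : Subset n) → IsGammaPSet G p D → ∣ D ∣ ≡ γ
  γSet-size G p γ hγ@(D₀ , (pd₀ , _) , e₀) D (pdD , minD) =
    ≤-antisym (subst (∣ D ∣ ≤_) e₀ (minD D₀ pd₀)) (γ-≤ G p γ hγ D pdD)

  γ-sized⇒γSet : (G : Graph n) (p γ : ℕ) → IsGammaP G p γ → (X : Subset n) →
                 IsPDom G p X → ∣ X ∣ ≡ γ → IsGammaPSet G p X
  γ-sized⇒γSet G p γ hγ X pdX e = pdX , λ D' pd' → subst (_≤ ∣ D' ∣) (sym e) (γ-≤ G p γ hγ D' pd')

  η-transfer : (G : Graph n) (p : ℕ) (w : Fin n) (A Z : Subset n) (e : ℕ) →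
               lookup Z w ≡ lookup A w → degIn G w A ≤ degIn G w Z + e → η G p w Z ≤ η G p w A + e
  η-transfer G p w A Z e same deg≤ = by-cases (lookup A w)
    (λ inA → subst (_≤ η G p w A + e) (sym (η-member G p w Z (trans same inA))) z≤n)
    (λ outA → η-≤ G p w Z (η G p w A + e) (trans same outA) (begin
        p
      ≤⟨ m≤n+m∸n p (degIn G w A) ⟩
        degIn G w A + (p ∸ degIn G w A)
      ≡⟨ cong (degIn G w A +_) (sym (η-outside G p w A outA)) ⟩
        degIn G w A + η G p w A
      ≤⟨ +-monoˡ-≤ (η G p w A) deg≤ ⟩
        degIn G w Z + e + η G p w A
      ≡⟨ trans (+-assoc (degIn G w Z) e _) (cong (degIn G w Z +_) (+-comm e (η G p w A))) ⟩
        degIn G w Z + (η G p w A + e)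
      ∎))
    where open ≤-Reasoning

-- The branches of a tree T at a vertex c: the components of T - c, each
-- named by its unique vertex adjacent to c.
module Branches {n : ℕ} (T : Graph n) (tree : IsTree T) (c : Fin n) where

  open import Data.List.Membership.DecPropositional (_≟_ {n}) using (_∈?_)

  private
    WA : Fin n → Fin n → Set
    WA = WalkAvoiding T c

  wa-head : ∀ {a b} → WA a b → a ≢ c
  wa-head (here a≢c) = a≢c
  wa-head (step a≢c _ _) = a≢c

  wa-last : ∀ {a b} → WA a b → b ≢ c
  wa-last (here b≢c) = b≢c
  wa-last (step _ _ W) = wa-last W

  wa-++ : ∀ {a b d} → WA a b → WA b d → WA a d
  wa-++ (here _) W₂ = W₂
  wa-++ (step a≢c e W) W₂ = step a≢c e (wa-++ W W₂)

  wa-reverse : ∀ {a b} → WA a b → WA b a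
  wa-reverse (here a≢c) = here a≢c
  wa-reverse (step {u} {w} u≢c e W) =
    wa-++ (wa-reverse W) (step (wa-head W) (trans (Graph.sym T w u) e) (here u≢c))

  data EndsAt : Fin n → List (Fin n) → Fin n → Set where
    end  : ∀ {a} → EndsAt a [] a
    more : ∀ {a r rs b} → EndsAt r rs b → EndsAt a (r ∷ rs) b

  Path : Fin n → Fin n → Set
  Path a b = Σ (List (Fin n)) λ rs →
    Chain T (a ∷ rs) × EndsAt a rs b × All (_≢ c) (a ∷ rs) × Unique (a ∷ rs)

  suffix-from : ∀ a h rs {b} → Any (a ≡_) (h ∷ rs) → Chain T (h ∷ rs) → EndsAt h rs b →
                All (_≢ c) (h ∷ rs) → Unique (h ∷ rs) → Path a b
  suffix-from a .a rs (here refl) ch l av u = rs , ch , l , av , u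
  suffix-from a h (r ∷ rs) (there a∈rs) (_ , ch) (more l) (_ ∷ av) (_ ∷ u) =
    suffix-from a r rs a∈rs ch l av u

  walk⇒path : ∀ {a b} → WA a b → Path a b
  walk⇒path (here a≢c) = [] , tt , end , (a≢c ∷ []) , ([] ∷ [])
  walk⇒path {a} (step {w = w} a≢c e W) with walk⇒path W
  ... | rs , ch , l , av , u with a ∈? (w ∷ rs)
  ...   | yes a∈ = suffix-from a w rs a∈ ch l av u
  ...   | no a∉ = (w ∷ rs) , (e , ch) , more l , (a≢c ∷ av) , (¬Any⇒All¬ (w ∷ rs) a∉ ∷ u)

  chain-snoc : ∀ {a rs b d} → Chain T (a ∷ rs) → EndsAt a rs b → adj T b d ≡ true →
               Chain T (a ∷ rs ++ [ d ])
  chain-snoc {rs = []} ch end e = e , tt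
  chain-snoc {rs = r ∷ rs} (e₁ , ch) (more l) e = e₁ , chain-snoc ch l e

  -- Two neighbours of c joined in T - c coincide: otherwise, closing the
  -- path between them through c would give a cycle of T.
  branch-unique : ∀ {v v'} → adj T c v ≡ true → adj T c v' ≡ true → WA v v' → v ≡ v'
  branch-unique {v} {v'} cv cv' W with v ≟ v' | walk⇒path W
  ... | yes v≡v' | _ = v≡v'
  ... | no v≢v' | [] , _ , end , _ = contradiction refl v≢v'
  ... | no _ | (r ∷ rs) , ch , l , av , u =
    contradiction
      ( s≤s (s≤s z≤n)
      , (All-map (λ a≢c c≡a → a≢c (sym c≡a)) av ∷ u)
      , (cv , chain-snoc ch l (trans (Graph.sym T v' c) cv')))
      (proj₂ (proj₂ tree) c (v ∷ r ∷ rs))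

  last-visit : ∀ {a w} → Walk T a w → w ≢ c → WA a w ⊎ Σ (Fin n) (λ v → adj T c v ≡ true × WA v w)
  last-visit here w≢c = inj₁ (here w≢c)
  last-visit (step {u} {m} e W) w≢c with last-visit W w≢c
  ... | inj₂ r = inj₂ r
  ... | inj₁ W' with u ≟ c
  ...   | yes refl = inj₂ (m , e , W')
  ...   | no u≢c = inj₁ (step u≢c e W')

  reach : (w : Fin n) → w ≢ c → Σ (Fin n) (λ v → adj T c v ≡ true × WA v w)
  reach w w≢c with last-visit (proj₁ (proj₂ tree) c w) w≢c
  ... | inj₁ W = contradiction refl (wa-head W)
  ... | inj₂ r = r

  -- The root of w ≠ c: the neighbour of c in the branch containing w.
  root : Fin n → Fin n
  root w with w ≟ c
  ... | yes _ = c
  ... | no w≢c = proj₁ (reach w w≢c)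

  root-adj : ∀ w → w ≢ c → adj T c (root w) ≡ true
  root-adj w w≢c with w ≟ c
  ... | yes w≡c = contradiction w≡c w≢c
  ... | no w≢c' = proj₁ (proj₂ (reach w w≢c'))

  root-walk : ∀ w → w ≢ c → WA (root w) w
  root-walk w w≢c with w ≟ c
  ... | yes w≡c = contradiction w≡c w≢c
  ... | no w≢c' = proj₂ (proj₂ (reach w w≢c'))

  inBranch : Fin n → Fin n → Bool
  inBranch v w = not (w == c) ∧ (root w == v)

  inBranch⇒ : ∀ v w → inBranch v w ≡ true → (w ≢ c) × (root w ≡ v)
  inBranch⇒ v w h with w ≟ c | root w ≟ v
  ... | no w≢c | yes r≡v = w≢c , r≡v
  ... | no _ | no _ = contradiction h λ ()
  ... | yes _ | _ = contradiction h λ ()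

  inBranch-intro : ∀ {v w} → w ≢ c → root w ≡ v → inBranch v w ≡ true
  inBranch-intro {v} {w} w≢c r≡v rewrite ==-≢ w≢c | r≡v = ==-refl v

  inBranch-centre : ∀ v → inBranch v c ≡ false
  inBranch-centre v rewrite ==-refl c = refl

  walk⇒inBranch : ∀ {v w} → adj T c v ≡ true → WA v w → inBranch v w ≡ true
  walk⇒inBranch {v} {w} cv W = inBranch-intro w≢c
    (sym (branch-unique cv (root-adj w w≢c) (wa-++ W (wa-reverse (root-walk w w≢c)))))
    where
    w≢c : w ≢ c
    w≢c = wa-last W

  inBranch⇒walk : ∀ v w → inBranch v w ≡ true → WA v w
  inBranch⇒walk v w h = subst (λ r → WA r w) (proj₂ (inBranch⇒ v w h)) (root-walk w (proj₁ (inBranch⇒ v w h)))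

  inBranch⇒adj : ∀ v w → inBranch v w ≡ true → adj T c v ≡ true
  inBranch⇒adj v w h = subst (λ r → adj T c r ≡ true) (proj₂ (inBranch⇒ v w h)) (root-adj w (proj₁ (inBranch⇒ v w h)))

  inBranch-closed : ∀ v t w → inBranch v t ≡ true → adj T t w ≡ true → w ≢ c → inBranch v w ≡ true
  inBranch-closed v t w h e w≢c =
    walk⇒inBranch (inBranch⇒adj v t h) (wa-++ (inBranch⇒walk v t h) (step (proj₁ (inBranch⇒ v t h)) e (here w≢c)))

  inBranch-neighbour : ∀ v t → adj T c t ≡ true → inBranch v t ≡ true → t ≡ v
  inBranch-neighbour v t ct h =
    trans (sym (proj₂ (inBranch⇒ t t (walk⇒inBranch ct (here (proj₁ (inBranch⇒ v t h)))))))
          (proj₂ (inBranch⇒ v t h))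

  inBranch-root : ∀ v → adj T c v ≡ true → inBranch v v ≡ true
  inBranch-root v cv = walk⇒inBranch cv (here v≢c)
    where
    v≢c : v ≢ c
    v≢c refl = contradiction (trans (sym cv) (Graph.irrefl T c)) λ ()

  -- Every vertex other than c lies in exactly one branch, so a sum over the
  -- vertices splits as the centre plus one sub-sum per neighbour of c.
  ∑-branches : (f : Fin n → ℕ) →
    ∑ n f ≡ f c + ∑ n (λ v → when (adj T c v) (∑ n (λ w → when (inBranch v w) (f w))))
  ∑-branches f = begin
      ∑ n f
    ≡⟨ ∑-split n c f ⟩
      f c + ∑ n (λ w → when (not (w == c)) (f w))
    ≡⟨ cong (f c +_) (∑-cong n one-branch) ⟨
      f c + ∑ n (λ w → ∑ n (λ v → when (adj T c v ∧ inBranch v w) (f w)))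
    ≡⟨ cong (f c +_) (∑-swap n n (λ w v → when (adj T c v ∧ inBranch v w) (f w))) ⟩
      f c + ∑ n (λ v → ∑ n (λ w → when (adj T c v ∧ inBranch v w) (f w)))
    ≡⟨ cong (f c +_) (∑-cong n λ v → trans (∑-cong n (λ w → when-∧ (adj T c v) (inBranch v w) (f w)))
                                            (sym (when-∑ n (adj T c v) _))) ⟩
      f c + ∑ n (λ v → when (adj T c v) (∑ n (λ w → when (inBranch v w) (f w))))
    ∎
    where
    open ≡-Reasoning
    one-branch : ∀ w → ∑ n (λ v → when (adj T c v ∧ inBranch v w) (f w)) ≡ when (not (w == c)) (f w)
    one-branch w = decide (w ≟ c)
      where
      decide : Dec (w ≡ c) → ∑ n (λ v → when (adj T c v ∧ inBranch v w) (f w)) ≡ when (not (w == c)) (f w)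
      decide (yes refl) rewrite ==-refl c = ∑-zero n (λ v → cong (λ b → when b (f c)) (∧-zeroʳ (adj T c v)))
      decide (no w≢c) rewrite ==-≢ w≢c = trans (∑-cong n at-root) (∑-point n (root w) (λ _ → f w))
        where
        at-root : ∀ v → when (adj T c v ∧ (root w == v)) (f w) ≡ when (v == root w) (f w)
        at-root v with root w ≟ v
        ... | yes refl rewrite root-adj w w≢c | ==-refl (root w) = refl
        ... | no r≢v rewrite ==-≢ (λ v≡r → r≢v (sym v≡r)) = cong (λ b → when b (f w)) (∧-zeroʳ (adj T c v))

prefix : ∀ {m} → ℕ → Vec Bool m → Vec Bool m
prefix k [] = []
prefix zero (b ∷ bs) = false ∷ prefix zero bs
prefix (suc k) (true ∷ bs) = true ∷ prefix k bs
prefix (suc k) (false ∷ bs) = false ∷ prefix (suc k) bs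

prefix-⊑ : ∀ {m} k (A : Vec Bool m) → prefix k A ⊑ A
prefix-⊑ zero (b ∷ bs) (fsuc i) e = prefix-⊑ zero bs i e
prefix-⊑ (suc k) (true ∷ bs) fzero e = refl
prefix-⊑ (suc k) (true ∷ bs) (fsuc i) e = prefix-⊑ k bs i e
prefix-⊑ (suc k) (false ∷ bs) (fsuc i) e = prefix-⊑ (suc k) bs i e

prefix-size≤ : ∀ {m} k (A : Vec Bool m) → ∣ prefix k A ∣ ≤ k
prefix-size≤ k [] = z≤n
prefix-size≤ zero (b ∷ bs) = prefix-size≤ zero bs
prefix-size≤ (suc k) (true ∷ bs) = s≤s (prefix-size≤ k bs)
prefix-size≤ (suc k) (false ∷ bs) = prefix-size≤ (suc k) bs

prefix-size : ∀ {m} k (A : Vec Bool m) → k ≤ ∣ A ∣ → ∣ prefix k A ∣ ≡ k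
prefix-size zero [] _ = refl
prefix-size zero (b ∷ bs) _ = prefix-size zero bs z≤n
prefix-size (suc k) (true ∷ bs) (s≤s k≤) = cong suc (prefix-size k bs k≤)
prefix-size (suc k) (false ∷ bs) k≤ = prefix-size (suc k) bs k≤

module _ {n : ℕ} where

  lookup-∪ : (A B : Subset n) (i : Fin n) → lookup (A ∪ B) i ≡ (lookup A i ∨ lookup B i)
  lookup-∪ A B i = lookup-zipWith _∨_ i A B

  ⊑-∪ : (A B : Subset n) → A ⊑ (A ∪ B)
  ⊑-∪ A B i e = trans (lookup-∪ A B i) (cong (_∨ lookup B i) e)

  ∣∪∣-disjoint : (A B : Subset n) → (∀ i → lookup B i ≡ true → lookup A i ≡ false) →
                 ∣ A ∪ B ∣ ≡ ∣ A ∣ + ∣ B ∣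
  ∣∪∣-disjoint A B disj = begin
      ∣ A ∪ B ∣
    ≡⟨ card-∑ (A ∪ B) ⟩
      ∑ n (λ i → 𝟙 (lookup (A ∪ B) i))
    ≡⟨ ∑-cong n (λ i → trans (cong 𝟙 (lookup-∪ A B i)) (𝟙-∨ (lookup A i) (lookup B i) (disj i))) ⟩
      ∑ n (λ i → 𝟙 (lookup A i) + 𝟙 (lookup B i))
    ≡⟨ ∑-+ n _ _ ⟩
      ∑ n (λ i → 𝟙 (lookup A i)) + ∑ n (λ i → 𝟙 (lookup B i))
    ≡⟨ cong₂ _+_ (card-∑ A) (card-∑ B) ⟨
      ∣ A ∣ + ∣ B ∣
    ∎
    where
    open ≡-Reasoning
    𝟙-∨ : ∀ a b → (b ≡ true → a ≡ false) → 𝟙 (a ∨ b) ≡ 𝟙 a + 𝟙 b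
    𝟙-∨ true true disjoint = contradiction (disjoint refl) λ ()
    𝟙-∨ true false _ = refl
    𝟙-∨ false b _ = refl

  pad : (S : Subset n) (k : ℕ) → k ≤ n → Σ (Subset n) λ S' → S ⊑ S' × ∣ S' ∣ ≡ ∣ S ∣ + (k ∸ ∣ S ∣)
  pad S k k≤n = S ∪ P , ⊑-∪ S P ,
    trans (∣∪∣-disjoint S P outside) (cong (∣ S ∣ +_) (prefix-size (k ∸ ∣ S ∣) (∁ S) room))
    where
    P : Subset n
    P = prefix (k ∸ ∣ S ∣) (∁ S)
    room : k ∸ ∣ S ∣ ≤ ∣ ∁ S ∣
    room = subst (k ∸ ∣ S ∣ ≤_) (sym (∣∁p∣≡n∸∣p∣ S)) (∸-monoˡ-≤ ∣ S ∣ k≤n)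
    outside : ∀ i → lookup P i ≡ true → lookup S i ≡ false
    outside i e = by-cases (lookup S i) (λ eS → contradiction (trans (sym (prefix-⊑ _ (∁ S) i e)) (complement eS)) λ ())
                                        (λ eS → eS)
      where
      complement : lookup S i ≡ true → lookup (∁ S) i ≡ false
      complement eS = trans (lookup-map i not S) (cong not eS)

  symClosure : (R : Fin n → Fin n → Bool) → (∀ v → R v v ≡ false) → Graph n
  symClosure R irr = record
    { adj = λ u v → R u v ∨ R v u
    ; sym = λ u v → ∨-comm (R u v) (R v u)
    ; irrefl = λ v → cong₂ _∨_ (irr v) (irr v)
    }

  -- Every edge of the closure is witnessed by an R-related ordered pair.
  edgeCount-symClosure : (R : Fin n → Fin n → Bool) (irr : ∀ v → R v v ≡ false) →
                         edgeCount (symClosure R irr) ≤ ∑ n (λ i → ∑ n (λ j → 𝟙 (R i j)))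
  edgeCount-symClosure R irr = begin
      edgeCount (symClosure R irr)
    ≡⟨ sumV≡∑ (λ i → ∣ tabulate (λ j → (R i j ∨ R j i) ∧ lt i j) ∣) ⟩
      ∑ n (λ i → ∣ tabulate (λ j → (R i j ∨ R j i) ∧ lt i j) ∣)
    ≡⟨ ∑-cong n (λ i → card-tabulate (λ j → (R i j ∨ R j i) ∧ lt i j)) ⟩
      ∑ n (λ i → ∑ n (λ j → 𝟙 ((R i j ∨ R j i) ∧ lt i j)))
    ≤⟨ ∑-mono n (λ i → ∑-mono n (λ j → 𝟙-∨∧ (R i j) (R j i) (lt i j))) ⟩
      ∑ n (λ i → ∑ n (λ j → 𝟙 (R i j ∧ lt i j) + 𝟙 (R j i ∧ lt i j)))
    ≡⟨ ∑-cong n (λ i → ∑-+ n _ _) ⟩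
      ∑ n (λ i → ∑ n (λ j → 𝟙 (R i j ∧ lt i j)) + ∑ n (λ j → 𝟙 (R j i ∧ lt i j)))
    ≡⟨ ∑-+ n _ _ ⟩
      ∑ n (λ i → ∑ n (λ j → 𝟙 (R i j ∧ lt i j))) + ∑ n (λ i → ∑ n (λ j → 𝟙 (R j i ∧ lt i j)))
    ≡⟨ cong (∑ n (λ i → ∑ n (λ j → 𝟙 (R i j ∧ lt i j))) +_) (∑-swap n n (λ i j → 𝟙 (R j i ∧ lt i j))) ⟩
      ∑ n (λ i → ∑ n (λ j → 𝟙 (R i j ∧ lt i j))) + ∑ n (λ i → ∑ n (λ j → 𝟙 (R i j ∧ lt j i)))
    ≡⟨ ∑-+ n _ _ ⟨
      ∑ n (λ i → ∑ n (λ j → 𝟙 (R i j ∧ lt i j)) + ∑ n (λ j → 𝟙 (R i j ∧ lt j i)))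
    ≡⟨ ∑-cong n (λ i → ∑-+ n _ _) ⟨
      ∑ n (λ i → ∑ n (λ j → 𝟙 (R i j ∧ lt i j) + 𝟙 (R i j ∧ lt j i)))
    ≤⟨ ∑-mono n (λ i → ∑-mono n (λ j → 𝟙-∧-asym (R i j) (lt i j) (lt j i) (lt-asym i j))) ⟩
      ∑ n (λ i → ∑ n (λ j → 𝟙 (R i j)))
    ∎
    where
    open ≤-Reasoning
    lt : Fin n → Fin n → Bool
    lt i j = toℕ i <ᵇ toℕ j
    lt-asym : ∀ i j → lt i j ≡ true → lt j i ≡ true → ⊥
    lt-asym i j e₁ e₂ = contradiction (<ᵇ⇒< (toℕ j) (toℕ i) (subst IsTrue (sym e₂) _))
                                      (<⇒≯ (<ᵇ⇒< (toℕ i) (toℕ j) (subst IsTrue (sym e₁) _)))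
    𝟙-∨∧ : ∀ a b c → 𝟙 ((a ∨ b) ∧ c) ≤ 𝟙 (a ∧ c) + 𝟙 (b ∧ c)
    𝟙-∨∧ true b true = s≤s z≤n
    𝟙-∨∧ false b true = ≤-refl
    𝟙-∨∧ a b false rewrite ∧-zeroʳ (a ∨ b) = z≤n
    𝟙-∧-asym : ∀ a c d → (c ≡ true → d ≡ true → ⊥) → 𝟙 (a ∧ c) + 𝟙 (a ∧ d) ≤ 𝟙 a
    𝟙-∧-asym false c d _ = z≤n
    𝟙-∧-asym true true true asym = ⊥-elim (asym refl refl)
    𝟙-∧-asym true true false _ = ≤-refl
    𝟙-∧-asym true false d _ = 𝟙≤1 d

  -- Completing a set S with p ≤ |S| to a p-dominating set of G + B: every
  -- u ∉ S is joined to η_p(u, S) vertices of S not adjacent to it.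
  module Completion (G : Graph n) (p : ℕ) (S : Subset n) (p≤∣S∣ : p ≤ ∣ S ∣) where

    free : Fin n → Subset n
    free u = tabulate (λ j → lookup S j ∧ not (adj G u j))

    chosen : Fin n → Subset n
    chosen u = prefix (η G p u S) (free u)

    chosen⇒ : ∀ u v → lookup (chosen u) v ≡ true → (lookup S v ≡ true) × (adj G u v ≡ false)
    chosen⇒ u v e = ∧-not _ _ (trans (sym (lookup∘tabulate _ v)) (prefix-⊑ _ (free u) v e))
      where
      ∧-not : ∀ a b → (a ∧ not b) ≡ true → (a ≡ true) × (b ≡ false)
      ∧-not true false _ = refl , refl

    new : Fin n → Fin n → Bool
    new u v = not (lookup S u) ∧ lookup (chosen u) v

    new⇒ : ∀ u v → new u v ≡ true → (lookup S u ≡ false) × (lookup S v ≡ true) × (adj G u v ≡ false)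
    new⇒ u v e = by-cases (lookup S u)
      (λ eu → contradiction (trans (sym e) (cong (λ b → not b ∧ lookup (chosen u) v) eu)) λ ())
      (λ eu → eu , chosen⇒ u v (trans (sym (cong (λ b → not b ∧ lookup (chosen u) v) eu)) e))

    new-irrefl : ∀ v → new v v ≡ false
    new-irrefl v = by-cases (new v v) loop (λ e → e)
      where
      loop : new v v ≡ true → new v v ≡ false
      loop e = contradiction (trans (sym (proj₁ (new⇒ v v e))) (proj₁ (proj₂ (new⇒ v v e)))) λ ()

    B : Graph n
    B = symClosure new new-irrefl

    nonEdges : NonEdges G B
    nonEdges u v e with new u v in e₁
    ... | true = proj₂ (proj₂ (new⇒ u v e₁))
    ... | false = trans (Graph.sym G u v) (proj₂ (proj₂ (new⇒ v u e)))

    free-size : ∀ u → ∣ free u ∣ + degIn G u S ≡ ∣ S ∣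
    free-size u = begin
        ∣ free u ∣ + degIn G u S
      ≡⟨ cong₂ _+_ (card-tabulate (λ j → lookup S j ∧ not (adj G u j))) (degIn-∑ G u S) ⟩
        ∑ n (λ j → 𝟙 (lookup S j ∧ not (adj G u j))) + ∑ n (λ j → 𝟙 (adj G u j ∧ lookup S j))
      ≡⟨ ∑-+ n _ _ ⟨
        ∑ n (λ j → 𝟙 (lookup S j ∧ not (adj G u j)) + 𝟙 (adj G u j ∧ lookup S j))
      ≡⟨ ∑-cong n (λ j → 𝟙-split (lookup S j) (adj G u j)) ⟩
        ∑ n (λ j → 𝟙 (lookup S j))
      ≡⟨ card-∑ S ⟨
        ∣ S ∣
      ∎
      where
      open ≡-Reasoning
      𝟙-split : ∀ s a → 𝟙 (s ∧ not a) + 𝟙 (a ∧ s) ≡ 𝟙 s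
      𝟙-split true true = refl
      𝟙-split true false = refl
      𝟙-split false true = refl
      𝟙-split false false = refl

    -- Since p ≤ |S|, a vertex outside S really gets its η_p(u, S) new neighbours.
    chosen-size : ∀ u → lookup S u ≡ false → ∣ chosen u ∣ ≡ p ∸ degIn G u S
    chosen-size u e = trans (prefix-size (η G p u S) (free u) enough) (η-outside G p u S e)
      where
      enough : η G p u S ≤ ∣ free u ∣
      enough = subst₂ _≤_ (sym (η-outside G p u S e))
                          (trans (cong (_∸ degIn G u S) (sym (free-size u))) (m+n∸n≡m ∣ free u ∣ (degIn G u S)))
                          (∸-monoˡ-≤ (degIn G u S) p≤∣S∣)

    dominates : IsPDom (G ⊕ B) p S
    dominates v v∉S = begin
        p
      ≤⟨ m≤n+m∸n p (degIn G v S) ⟩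
        degIn G v S + (p ∸ degIn G v S)
      ≡⟨ cong₂ _+_ (degIn-∑ G v S) (trans (sym (chosen-size v Sv)) (card-∑ (chosen v))) ⟩
        ∑ n (λ w → 𝟙 (adj G v w ∧ lookup S w)) + ∑ n (λ w → 𝟙 (lookup (chosen v) w))
      ≡⟨ ∑-+ n _ _ ⟨
        ∑ n (λ w → 𝟙 (adj G v w ∧ lookup S w) + 𝟙 (lookup (chosen v) w))
      ≤⟨ ∑-mono n gain ⟩
        ∑ n (λ w → 𝟙 (adj (G ⊕ B) v w ∧ lookup S w))
      ≡⟨ degIn-∑ (G ⊕ B) v S ⟨
        degIn (G ⊕ B) v S
      ∎
      where
      open ≤-Reasoning
      Sv : lookup S v ≡ false
      Sv = ∉⇒lookup S v v∉S
      𝟙-gain : ∀ a s c x → (c ≡ true → (s ≡ true) × (a ≡ false)) → 𝟙 (a ∧ s) + 𝟙 c ≤ 𝟙 ((a ∨ (c ∨ x)) ∧ s)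
      𝟙-gain a s true x c⇒ with c⇒ refl
      ... | refl , refl = ≤-refl
      𝟙-gain true true false x _ = ≤-refl
      𝟙-gain true false false x _ = z≤n
      𝟙-gain false s false x _ = z≤n
      gain : ∀ w → 𝟙 (adj G v w ∧ lookup S w) + 𝟙 (lookup (chosen v) w) ≤
                   𝟙 ((adj G v w ∨ (new v w ∨ new w v)) ∧ lookup S w)
      gain w = subst (λ c → 𝟙 (adj G v w ∧ lookup S w) + 𝟙 (lookup (chosen v) w) ≤ 𝟙 ((adj G v w ∨ (c ∨ new w v)) ∧ lookup S w))
                     (cong (λ b → not b ∧ lookup (chosen v) w) (sym Sv))
                     (𝟙-gain (adj G v w) (lookup S w) (lookup (chosen v) w) (new w v) (chosen⇒ v w))

    new-row : ∀ u → ∑ n (λ v → 𝟙 (new u v)) ≤ η G p u S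
    new-row u = by-cases (lookup S u) inside outside
      where
      inside : lookup S u ≡ true → ∑ n (λ v → 𝟙 (new u v)) ≤ η G p u S
      inside e = subst (_≤ η G p u S) (sym (∑-zero n (λ v → cong (λ b → 𝟙 (not b ∧ lookup (chosen u) v)) e))) z≤n
      outside : lookup S u ≡ false → ∑ n (λ v → 𝟙 (new u v)) ≤ η G p u S
      outside e = subst (_≤ η G p u S)
                        (trans (card-∑ (chosen u)) (∑-cong n (λ v → cong (λ b → 𝟙 (not b ∧ lookup (chosen u) v)) (sym e))))
                        (prefix-size≤ (η G p u S) (free u))

    few-edges : edgeCount B ≤ ηV G p S
    few-edges = begin
        edgeCount B
      ≤⟨ edgeCount-symClosure new new-irrefl ⟩
        ∑ n (λ u → ∑ n (λ v → 𝟙 (new u v)))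
      ≤⟨ ∑-mono n new-row ⟩
        ∑ n (λ u → η G p u S)
      ≡⟨ ηV-∑ G p S ⟨
        ηV G p S
      ∎
      where open ≤-Reasoning

  completion : (G : Graph n) (p : ℕ) (S : Subset n) → p ≤ ∣ S ∣ →
               Σ (Graph n) λ B → NonEdges G B × IsPDom (G ⊕ B) p S × edgeCount B ≤ ηV G p S
  completion G p S p≤∣S∣ = B , nonEdges , dominates , few-edges
    where open Completion G p S p≤∣S∣

module _ {n : ℕ} where

  -- Adding a deficient vertex w to S removes its whole deficiency (at least
  -- one) and raises no other one.
  ηV-add : (G : Graph n) (p : ℕ) (S : Subset n) (w : Fin n) → 0 < η G p w S →
           ηV G p (S ∪ ⁅ w ⁆) + 1 ≤ ηV G p S
  ηV-add G p S w deficient = subst₂ _≤_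
    (trans (∑-+ n _ _) (cong₂ _+_ (sym (ηV-∑ G p S')) (trans (sym (card-∑ ⁅ w ⁆)) (∣⁅x⁆∣≡1 w))))
    (sym (ηV-∑ G p S))
    (∑-mono n drop)
    where
    S' : Subset n
    S' = S ∪ ⁅ w ⁆
    drop : ∀ t → η G p t S' + 𝟙 (lookup ⁅ w ⁆ t) ≤ η G p t S
    drop t = by-cases (lookup ⁅ w ⁆ t) added other
      where
      added : lookup ⁅ w ⁆ t ≡ true → η G p t S' + 𝟙 (lookup ⁅ w ⁆ t) ≤ η G p t S
      added e = subst₂ (λ a b → a + 𝟙 b ≤ η G p t S) (sym (η-member G p t S' inS')) (sym e)
                       (subst (λ u → 0 < η G p u S) (sym (x∈⁅y⁆⇒x≡y w (lookup⇒[]= t ⁅ w ⁆ e))) deficient)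
        where
        inS' : lookup S' t ≡ true
        inS' = trans (lookup-∪ S ⁅ w ⁆ t) (trans (cong (lookup S t ∨_) e) (∨-zeroʳ (lookup S t)))
      other : lookup ⁅ w ⁆ t ≡ false → η G p t S' + 𝟙 (lookup ⁅ w ⁆ t) ≤ η G p t S
      other e = subst (λ b → η G p t S' + 𝟙 b ≤ η G p t S) (sym e)
                      (subst (_≤ η G p t S) (sym (+-identityʳ _)) (η-antitone G p t S S' (⊑-∪ S ⁅ w ⁆)))

  deficient⇒outside : (G : Graph n) (p : ℕ) (S : Subset n) (w : Fin n) → 0 < η G p w S → lookup S w ≡ false
  deficient⇒outside G p S w deficient =
    by-cases (lookup S w) (λ e → contradiction (subst (0 <_) (η-member G p w S e) deficient) λ ()) (λ e → e)

  -- If r_p(G) = r ≥ 1 (so γ_p(G) > p), then every set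
  -- S of fewer than γ_p(G) vertices has total deficiency η_p(V, S) ≥ r, since
  -- completing S with η_p(V, S) edges would reinforce G; for |S| + 1 < γ_p(G)
  -- even η_p(V, S) ≥ r + 1.
  module ReinforcementBound (G : Graph n) (p r : ℕ) (rp : IsRP G p r) (1≤r : 1 ≤ r)
                            (γ : ℕ) (hγ : IsGammaP G p γ) where

    -- By the convention r_p = 0 for γ_p ≤ p, here γ_p(G) > p.
    p<γ : p < γ
    p<γ = ≰⇒> (λ γ≤p → contradiction (subst (1 ≤_) (proj₁ (rp γ hγ) γ≤p) 1≤r) λ ())

    γ≤n : γ ≤ n
    γ≤n = subst (_≤ n) (proj₂ (proj₂ hγ)) (∣p∣≤n (proj₁ hγ))

    -- For p ≤ |S| < γ the completion of S is a reinforcing set of edges.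
    ηV-≥-large : (S : Subset n) → p ≤ ∣ S ∣ → ∣ S ∣ < γ → r ≤ ηV G p S
    ηV-≥-large S p≤∣S∣ ∣S∣<γ with completion G p S p≤∣S∣
    ... | B , nonEdges , dominates , few-edges = ≤-trans (proj₂ (proj₂ (rp γ hγ) p<γ) B nonEdges reinforces) few-edges
      where
      reinforces : Reinforces G p B
      reinforces γ₁ γ' hγ₁ hγ' = ≤-<-trans (γ-≤ (G ⊕ B) p γ' hγ' S dominates)
                                           (subst (∣ S ∣ <_) (γ-unique G p γ γ₁ hγ hγ₁) ∣S∣<γ)

    -- Small sets are first padded to p vertices, which only lowers deficiencies.
    ηV-≥ : (S : Subset n) → ∣ S ∣ < γ → r ≤ ηV G p S
    ηV-≥ S ∣S∣<γ with pad S p (≤-trans (<⇒≤ p<γ) γ≤n)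
    ... | S' , S⊑S' , size = ≤-trans (ηV-≥-large S' p≤∣S'∣ ∣S'∣<γ) (ηV-antitone G p S S' S⊑S')
      where
      p≤∣S'∣ : p ≤ ∣ S' ∣
      p≤∣S'∣ = subst (p ≤_) (sym size) (m≤n+m∸n p ∣ S ∣)
      ∣S'∣<γ : ∣ S' ∣ < γ
      ∣S'∣<γ with ≤-total ∣ S ∣ p
      ... | inj₁ ∣S∣≤p = subst (_< γ) (trans (sym (m+[n∸m]≡n ∣S∣≤p)) (sym size)) p<γ
      ... | inj₂ p≤∣S∣ = subst (_< γ) (trans (sym (+-identityʳ ∣ S ∣)) (sym nothing-added)) ∣S∣<γ
        where
        nothing-added : ∣ S' ∣ ≡ ∣ S ∣ + 0
        nothing-added = trans size (cong (∣ S ∣ +_) (m≤n⇒m∸n≡0 p≤∣S∣))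

    -- With room for one more vertex, add a deficient one and apply ηV-≥ again.
    ηV-≥-suc : (S : Subset n) → ∣ S ∣ + 1 < γ → r + 1 ≤ ηV G p S
    ηV-≥-suc S room with ∑-< n (λ _ → 0) (λ w → η G p w S) positive
      where
      positive : ∑ n (λ _ → 0) < ∑ n (λ w → η G p w S)
      positive = subst₂ _<_ (sym (∑-zero n (λ _ → refl))) (ηV-∑ G p S)
                            (≤-trans 1≤r (ηV-≥ S (≤-<-trans (m≤m+n ∣ S ∣ 1) room)))
    ... | w , deficient = ≤-trans (+-monoˡ-≤ 1 (ηV-≥ (S ∪ ⁅ w ⁆) (subst (_< γ) (sym size) room)))
                                  (ηV-add G p S w deficient)
      where
      size : ∣ S ∪ ⁅ w ⁆ ∣ ≡ ∣ S ∣ + 1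
      size = trans (∣∪∣-disjoint S ⁅ w ⁆ disjoint) (cong (∣ S ∣ +_) (∣⁅x⁆∣≡1 w))
        where
        disjoint : ∀ i → lookup ⁅ w ⁆ i ≡ true → lookup S i ≡ false
        disjoint i e rewrite x∈⁅y⁆⇒x≡y w (lookup⇒[]= i ⁅ w ⁆ e) = deficient⇒outside G p S w deficient

module _ {n : ℕ} where

  countIn : (Fin n → Bool) → Subset n → ℕ
  countIn L X = ∑ n (λ w → 𝟙 (L w ∧ lookup X w))

  splice : (Fin n → Bool) → Subset n → Subset n → Subset n
  splice L A B = tabulate (λ w → if L w then lookup A w else lookup B w)

  splice-in : ∀ L A B w → L w ≡ true → lookup (splice L A B) w ≡ lookup A w
  splice-in L A B w e rewrite lookup∘tabulate (λ w → if L w then lookup A w else lookup B w) w | e = refl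

  splice-out : ∀ L A B w → L w ≡ false → lookup (splice L A B) w ≡ lookup B w
  splice-out L A B w e rewrite lookup∘tabulate (λ w → if L w then lookup A w else lookup B w) w | e = refl

  splice-size : ∀ L A B → ∣ splice L A B ∣ + countIn L B ≡ countIn L A + ∣ B ∣
  splice-size L A B = begin
      ∣ splice L A B ∣ + countIn L B
    ≡⟨ cong (_+ countIn L B) (card-tabulate (λ w → if L w then lookup A w else lookup B w)) ⟩
      ∑ n (λ w → 𝟙 (if L w then lookup A w else lookup B w)) + countIn L B
    ≡⟨ ∑-+ n _ _ ⟨
      ∑ n (λ w → 𝟙 (if L w then lookup A w else lookup B w) + 𝟙 (L w ∧ lookup B w))
    ≡⟨ ∑-cong n (λ w → exchange (L w) (lookup A w) (lookup B w)) ⟩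
      ∑ n (λ w → 𝟙 (L w ∧ lookup A w) + 𝟙 (lookup B w))
    ≡⟨ ∑-+ n _ _ ⟩
      countIn L A + ∑ n (λ w → 𝟙 (lookup B w))
    ≡⟨ cong (countIn L A +_) (card-∑ B) ⟨
      countIn L A + ∣ B ∣
    ∎
    where
    open ≡-Reasoning
    exchange : ∀ l a b → 𝟙 (if l then a else b) + 𝟙 (l ∧ b) ≡ 𝟙 (l ∧ a) + 𝟙 b
    exchange true a b = refl
    exchange false a b = +-identityʳ (𝟙 b)

  ∣∩∣≡countIn : (X C : Subset n) (L : Fin n → Bool) → (∀ w → lookup C w ≡ L w) → ∣ X ∩ C ∣ ≡ countIn L X
  ∣∩∣≡countIn X C L C≡L = trans (card-∑ (X ∩ C)) (∑-cong n λ w → cong 𝟙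
    (trans (lookup-zipWith _∧_ w X C) (trans (cong (lookup X w ∧_) (C≡L w)) (∧-comm (lookup X w) (L w)))))

module BranchCounting {n : ℕ} (T : Graph n) (tree : IsTree T) (c : Fin n) where

  open Branches T tree c

  size-by-branches : (X : Subset n) →
    ∣ X ∣ ≡ 𝟙 (lookup X c) + ∑ n (λ v → when (adj T c v) (countIn (inBranch v) X))
  size-by-branches X =
    trans (card-∑ X) (trans (∑-branches (λ w → 𝟙 (lookup X w)))
      (cong (𝟙 (lookup X c) +_) (∑-cong n (λ v → cong (when (adj T c v))
        (∑-cong n (λ w → when-𝟙 (inBranch v w) (lookup X w)))))))

  branch-neighbour : ∀ v w t → inBranch v w ≡ true → adj T w t ≡ true →
                     inBranch v t ≡ true ⊎ (t ≡ c × w ≡ v)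
  branch-neighbour v w t hw wt = decide (t ≟ c)
    where
    decide : Dec (t ≡ c) → inBranch v t ≡ true ⊎ (t ≡ c × w ≡ v)
    decide (yes refl) = inj₂ (refl , inBranch-neighbour v w (trans (Graph.sym T c w) wt) hw)
    decide (no t≢c) = inj₁ (inBranch-closed v w t hw wt t≢c)

  outside-neighbour : ∀ v w t → inBranch v w ≡ false → w ≢ c → adj T w t ≡ true → inBranch v t ≡ false
  outside-neighbour v w t hw w≢c wt = by-cases (inBranch v t)
    (λ ht → contradiction (trans (sym (inBranch-closed v t w ht (trans (Graph.sym T t w) wt) w≢c)) hw) λ ())
    (λ ht → ht)

  -- Degrees in the splice Z of A (on the branch of v) and B (elsewhere):
  -- a vertex keeps its neighbours in its own part, except that v may lose c.
  module Spliced (v : Fin n) (A B : Subset n) where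

    Z : Subset n
    Z = splice (inBranch v) A B

    -- c is outside every branch, so Z takes it from B.
    Z-centre : lookup Z c ≡ lookup B c
    Z-centre = splice-out (inBranch v) A B c (inBranch-centre v)

    degIn-in-branch : ∀ w → inBranch v w ≡ true →
                      degIn T w A ≤ degIn T w Z + 𝟙 ((w == v) ∧ lookup A c)
    degIn-in-branch w hw = subst (degIn T w A ≤_) (cong (degIn T w Z +_) loss) (degIn-≤ T w A Z h pt)
      where
      h : Fin n → ℕ
      h t = 𝟙 ((w == v) ∧ ((t == c) ∧ lookup A t))
      loss : ∑ n h ≡ 𝟙 ((w == v) ∧ lookup A c)
      loss = begin
          ∑ n h
        ≡⟨ ∑-cong n (λ t → sym (when-𝟙 (w == v) _)) ⟩
          ∑ n (λ t → when (w == v) (𝟙 ((t == c) ∧ lookup A t)))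
        ≡⟨ when-∑ n (w == v) _ ⟨
          when (w == v) (∑ n (λ t → 𝟙 ((t == c) ∧ lookup A t)))
        ≡⟨ cong (when (w == v)) (trans (∑-cong n (λ t → sym (when-𝟙 (t == c) (lookup A t)))) (∑-point n c _)) ⟩
          when (w == v) (𝟙 (lookup A c))
        ≡⟨ when-𝟙 (w == v) (lookup A c) ⟩
          𝟙 ((w == v) ∧ lookup A c)
        ∎
        where open ≡-Reasoning
      pt : ∀ t → 𝟙 (adj T w t ∧ lookup A t) ≤ 𝟙 (adj T w t ∧ lookup Z t) + h t
      pt t with adj T w t in wt
      ... | false = z≤n
      ... | true with branch-neighbour v w t hw wt
      ...   | inj₁ ht rewrite splice-in (inBranch v) A B t ht = m≤m+n _ _
      ...   | inj₂ (refl , refl) rewrite ==-refl c | ==-refl v = m≤n+m _ _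

    degIn-out-branch : ∀ w → inBranch v w ≡ false → w ≢ c → degIn T w B ≤ degIn T w Z
    degIn-out-branch w hw w≢c = subst₂ _≤_ (sym (degIn-∑ T w B)) (sym (degIn-∑ T w Z)) (∑-mono n pt)
      where
      pt : ∀ t → 𝟙 (adj T w t ∧ lookup B t) ≤ 𝟙 (adj T w t ∧ lookup Z t)
      pt t with adj T w t in wt
      ... | false = z≤n
      ... | true rewrite splice-out (inBranch v) A B t (outside-neighbour v w t hw w≢c wt) = ≤-refl

    degIn-centre : degIn T c B ≤ degIn T c Z + 𝟙 (lookup B v)
    degIn-centre = subst (degIn T c B ≤_) (cong (degIn T c Z +_) loss) (degIn-≤ T c B Z h pt)
      where
      h : Fin n → ℕ
      h t = 𝟙 ((t == v) ∧ lookup B t)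
      loss : ∑ n h ≡ 𝟙 (lookup B v)
      loss = trans (∑-cong n (λ t → sym (when-𝟙 (t == v) (lookup B t)))) (∑-point n v _)
      pt : ∀ t → 𝟙 (adj T c t ∧ lookup B t) ≤ 𝟙 (adj T c t ∧ lookup Z t) + h t
      pt t with adj T c t in ct | inBranch v t in ht
      ... | false | _ = z≤n
      ... | true | false rewrite splice-out (inBranch v) A B t ht = m≤m+n _ _
      ... | true | true rewrite inBranch-neighbour v t ct ht | ==-refl v = m≤n+m _ _

    η-in-branch : ∀ p w → inBranch v w ≡ true → η T p w Z ≤ η T p w A + 𝟙 ((w == v) ∧ lookup A c)
    η-in-branch p w hw = η-transfer T p w A Z _ (splice-in (inBranch v) A B w hw) (degIn-in-branch w hw)

    η-out-branch : ∀ p w → inBranch v w ≡ false → w ≢ c → η T p w Z ≤ η T p w B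
    η-out-branch p w hw w≢c = subst (η T p w Z ≤_) (+-identityʳ _)
      (η-transfer T p w B Z 0 (splice-out (inBranch v) A B w hw)
                  (subst (degIn T w B ≤_) (sym (+-identityʳ _)) (degIn-out-branch w hw w≢c)))

    η-centre : ∀ p → η T p c Z ≤ η T p c B + 𝟙 (lookup B v)
    η-centre p = η-transfer T p c B Z _ Z-centre degIn-centre

    -- Splicing two p-dominating sets creates deficiency at most 2: only v
    -- (which may lose c) and c (which may lose v) can become deficient.
    ηV-splice-≤2 : ∀ p → IsPDom T p A → IsPDom T p B → ηV T p Z ≤ 2
    ηV-splice-≤2 p pdA pdB = begin
        ηV T p Z
      ≡⟨ ηV-∑ T p Z ⟩
        ∑ n (λ w → η T p w Z)
      ≤⟨ ∑-mono n (λ w → at (w ≟ c)) ⟩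
        ∑ n (λ w → 𝟙 (w == v) + 𝟙 (w == c))
      ≡⟨ trans (∑-+ n _ _) (cong₂ _+_ (∑-𝟙-point n v) (∑-𝟙-point n c)) ⟩
        2
      ∎
      where
      open ≤-Reasoning
      ηA : ∀ w → η T p w A ≡ 0
      ηA = pdom⇒η≡0 T p A pdA
      ηB : ∀ w → η T p w B ≡ 0
      ηB = pdom⇒η≡0 T p B pdB
      at : ∀ {w} → Dec (w ≡ c) → η T p w Z ≤ 𝟙 (w == v) + 𝟙 (w == c)
      at (yes refl) = begin
          η T p c Z
        ≤⟨ η-centre p ⟩
          η T p c B + 𝟙 (lookup B v)
        ≤⟨ subst (_≤ 1) (cong (_+ 𝟙 (lookup B v)) (sym (ηB c))) (𝟙≤1 (lookup B v)) ⟩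
          1
        ≡⟨ cong 𝟙 (==-refl c) ⟨
          𝟙 (c == c)
        ≤⟨ m≤n+m _ _ ⟩
          𝟙 (c == v) + 𝟙 (c == c)
        ∎
      at {w} (no w≢c) = ≤-trans (by-cases (inBranch v w) inside outside) (m≤m+n _ _)
        where
        inside : inBranch v w ≡ true → η T p w Z ≤ 𝟙 (w == v)
        inside hw = ≤-trans (η-in-branch p w hw)
                            (subst (_≤ 𝟙 (w == v)) (cong (_+ _) (sym (ηA w))) (𝟙-∧≤ (w == v) (lookup A c)))
        outside : inBranch v w ≡ false → η T p w Z ≤ 𝟙 (w == v)
        outside hw = ≤-trans (η-out-branch p w hw w≢c) (subst (_≤ 𝟙 (w == v)) (sym (ηB w)) z≤n)

    ηV-splice-≤-branch : ∀ p → lookup A c ≡ false → lookup B c ≡ true → IsPDom T p B →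
                         ηV T p Z ≤ ∑ n (λ w → when (inBranch v w) (η T p w A))
    ηV-splice-≤-branch p Ac Bc pdB =
      subst (_≤ _) (sym (ηV-∑ T p Z)) (∑-mono n (λ w → by-cases (inBranch v w) (inside w) (outside w)))
      where
      inside : ∀ w → inBranch v w ≡ true → η T p w Z ≤ when (inBranch v w) (η T p w A)
      inside w hw = subst (λ b → η T p w Z ≤ when b (η T p w A)) (sym hw) (subst (η T p w Z ≤_) no-loss (η-in-branch p w hw))
        where
        no-loss : η T p w A + 𝟙 ((w == v) ∧ lookup A c) ≡ η T p w A
        no-loss = trans (cong (λ b → η T p w A + 𝟙 b) (trans (cong ((w == v) ∧_) Ac) (∧-zeroʳ (w == v))))
                        (+-identityʳ _)
      outside : ∀ w → inBranch v w ≡ false → η T p w Z ≤ when (inBranch v w) (η T p w A)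
      outside w hw = subst (λ b → η T p w Z ≤ when b (η T p w A)) (sym hw) (≤-reflexive (decide (w ≟ c)))
        where
        decide : Dec (w ≡ c) → η T p w Z ≡ 0
        decide (yes refl) = η-member T p c Z (trans Z-centre Bc)
        decide (no w≢c) = n≤0⇒n≡0 (subst (η T p w Z ≤_) (pdom⇒η≡0 T p B pdB w) (η-out-branch p w hw w≢c))

  degIn-root-agree : ∀ v (X D : Subset n) → adj T c v ≡ true →
                     (∀ w → inBranch v w ≡ true → lookup X w ≡ lookup D w) →
                     lookup X c ≡ false → lookup D c ≡ true → degIn T v X + 1 ≤ degIn T v D
  degIn-root-agree v X D cv agree Xc Dc =
    subst₂ _≤_ (trans (∑-+ n _ _) (cong₂ _+_ (sym (degIn-∑ T v X)) (∑-𝟙-point n c))) (sym (degIn-∑ T v D))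
           (∑-mono n (λ t → at (t ≟ c)))
    where
    at : ∀ {t} → Dec (t ≡ c) → 𝟙 (adj T v t ∧ lookup X t) + 𝟙 (t == c) ≤ 𝟙 (adj T v t ∧ lookup D t)
    at (yes refl) rewrite trans (Graph.sym T v c) cv | Xc | Dc | ==-refl c = ≤-refl
    at {t} (no t≢c) rewrite ==-≢ t≢c | +-identityʳ (𝟙 (adj T v t ∧ lookup X t)) with adj T v t in vt
    ... | false = z≤n
    ... | true with branch-neighbour v v t (inBranch-root v cv) vt
    ...   | inj₁ ht rewrite agree t ht = ≤-refl
    ...   | inj₂ (t≡c , _) = contradiction t≡c t≢c

  component≡branch : ∀ y C → adj T c y ≡ true → IsComponentMinus T c y C → ∀ w → lookup C w ≡ inBranch y w
  component≡branch y C cy comp w = by-cases (lookup C w)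
    (λ w∈C → trans w∈C (sym (walk⇒inBranch cy (proj₁ (comp w) (lookup⇒[]= w C w∈C)))))
    (λ w∉C → by-cases (inBranch y w)
      (λ hw → contradiction (trans (sym ([]=⇒lookup (proj₂ (comp w) (inBranch⇒walk y w hw)))) w∉C) λ ())
      (λ hw → trans w∉C (sym hw)))

-- In a tree T with r_p(T) = r ≥ 3, if u lay in
-- one γ_p-set D₁ but not in another D₂, some branch at u would carry fewer
-- members of D₁ than of D₂; splicing D₁ into D₂ on that branch gives a set of
-- size below γ_p(T) with deficiency at most 2 < r, against the reinforcement bound.
module Uniqueness {n : ℕ} (T : Graph n) (tree : IsTree T) (p r : ℕ) (rp : IsRP T p r) (3≤r : 3 ≤ r)
                  (γ : ℕ) (hγ : IsGammaP T p γ) where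

  open ReinforcementBound T p r rp (≤-trans (s≤s z≤n) 3≤r) γ hγ using (ηV-≥)

  no-separating-vertex : (D₁ D₂ : Subset n) → IsGammaPSet T p D₁ → IsGammaPSet T p D₂ →
                         (u : Fin n) → lookup D₁ u ≡ true → lookup D₂ u ≡ false → ⊥
  no-separating-vertex D₁ D₂ g₁ g₂ u u∈D₁ u∉D₂ =
    3≰2 (≤-trans 3≤r (≤-trans (ηV-≥ Z ∣Z∣<γ) (ηV-splice-≤2 p (proj₁ g₁) (proj₁ g₂))))
    where
    open Branches T tree u
    open BranchCounting T tree u
    perBranch : Subset n → Fin n → ℕ
    perBranch X v = when (adj T u v) (countIn (inBranch v) X)
    fewer : ∑ n (perBranch D₁) < ∑ n (perBranch D₂)
    fewer = ≤-reflexive (begin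
        suc (∑ n (perBranch D₁))
      ≡⟨ cong (λ b → 𝟙 b + ∑ n (perBranch D₁)) u∈D₁ ⟨
        𝟙 (lookup D₁ u) + ∑ n (perBranch D₁)
      ≡⟨ size-by-branches D₁ ⟨
        ∣ D₁ ∣
      ≡⟨ trans (γSet-size T p γ hγ D₁ g₁) (sym (γSet-size T p γ hγ D₂ g₂)) ⟩
        ∣ D₂ ∣
      ≡⟨ size-by-branches D₂ ⟩
        𝟙 (lookup D₂ u) + ∑ n (perBranch D₂)
      ≡⟨ cong (λ b → 𝟙 b + ∑ n (perBranch D₂)) u∉D₂ ⟩
        ∑ n (perBranch D₂)
      ∎)
      where open ≡-Reasoning
    v : Fin n
    v = proj₁ (∑-< n (perBranch D₁) (perBranch D₂) fewer)
    fewer-at-v : countIn (inBranch v) D₁ < countIn (inBranch v) D₂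
    fewer-at-v = proj₂ (when-< (adj T u v) (proj₂ (∑-< n (perBranch D₁) (perBranch D₂) fewer)))
    open Spliced v D₁ D₂
    ∣Z∣<γ : ∣ Z ∣ < γ
    ∣Z∣<γ = subst₂ _<_ (+-identityʳ ∣ Z ∣) (γSet-size T p γ hγ D₂ g₂)
      (exchange-< (∣ Z ∣) (countIn (inBranch v) D₂) (countIn (inBranch v) D₁) (∣ D₂ ∣) 0
                  (splice-size (inBranch v) D₁ D₂)
                  (subst (_< countIn (inBranch v) D₂) (sym (+-identityʳ _)) fewer-at-v))

  γSet-unique : (D₁ D₂ : Subset n) → IsGammaPSet T p D₁ → IsGammaPSet T p D₂ → ∀ u → lookup D₁ u ≡ lookup D₂ u
  γSet-unique D₁ D₂ g₁ g₂ u with lookup D₁ u in e₁ | lookup D₂ u in e₂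
  ... | true | true = refl
  ... | false | false = refl
  ... | true | false = ⊥-elim (no-separating-vertex D₁ D₂ g₁ g₂ u e₁ e₂)
  ... | false | true = ⊥-elim (no-separating-vertex D₂ D₁ g₂ g₁ u e₂ e₁)

module Main {n : ℕ} (T : Graph n) (tree : IsTree T) (p : ℕ) (3≤p : 3 ≤ p) (rp : IsRP T p (p + 1))
            (D : Subset n) (γD : IsGammaPSet T p D) (x : Fin n) (x∈D : lookup D x ≡ true)
            (X : Subset n) (x∉X : lookup X x ≡ false) (γ : ℕ) (hγ : IsGammaP T p γ) (∣X∣<γ : ∣ X ∣ < γ)
            (μ≥p+2 : p + 2 ≤ μ T p x D) (ηVX≡p+1 : ηV T p X ≡ p + 1) where

  open Branches T tree x
  open BranchCounting T tree x
  open ReinforcementBound T p (p + 1) rp (m≤n+m 1 p) γ hγ using (ηV-≥; ηV-≥-suc)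
  open Uniqueness T tree p (p + 1) rp (≤-trans 3≤p (m≤m+n p 1)) γ hγ using (γSet-unique)

  a b e : Fin n → ℕ
  a v = countIn (inBranch v) X
  b v = countIn (inBranch v) D
  e v = ∑ n (λ w → when (inBranch v w) (η T p w X))

  a' b' e' : Fin n → ℕ
  a' v = when (adj T x v) (a v)
  b' v = when (adj T x v) (b v)
  e' v = when (adj T x v) (e v)

  Y : Fin n → Subset n
  Y v = Spliced.Z v X D

  ∣D∣≡γ : ∣ D ∣ ≡ γ
  ∣D∣≡γ = γSet-size T p γ hγ D γD

  Y-size : ∀ v → ∣ Y v ∣ + b v ≡ a v + γ
  Y-size v = trans (splice-size (inBranch v) X D) (cong (a v +_) ∣D∣≡γ)

  Y-deficiency : ∀ v → ηV T p (Y v) ≤ e v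
  Y-deficiency v = Spliced.ηV-splice-≤-branch v X D p x∉X x∈D (proj₁ γD)

  deficiency-by-branches : p + 1 ≡ η T p x X + ∑ n e'
  deficiency-by-branches = trans (sym ηVX≡p+1) (trans (ηV-∑ T p X) (∑-branches (λ w → η T p w X)))

  -- |X| < γ = |D| and x ∈ D ∖ X: the branches carry no more of X than of D.
  ∑a'≤∑b' : ∑ n a' ≤ ∑ n b'
  ∑a'≤∑b' = ≤-pred (subst₂ _<_
    (trans (size-by-branches X) (cong (λ β → 𝟙 β + ∑ n a') x∉X))
    (trans (sym ∣D∣≡γ) (trans (size-by-branches D) (cong (λ β → 𝟙 β + ∑ n b') x∈D)))
    ∣X∣<γ)

  module Deficit (i : Fin n) (xi : adj T x i ≡ true) (a<b : a i < b i) where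

    e'i≡ei : e' i ≡ e i
    e'i≡ei = cong (λ β → when β (e i)) xi

    ei≤p+1 : e i ≤ p + 1
    ei≤p+1 = subst₂ _≤_ e'i≡ei (sym deficiency-by-branches) (≤-trans (∑-term n e' i) (m≤n+m _ _))

    -- Y i is smaller than γ, so by the reinforcement bound it is far from dominating.
    Yi-small : ∣ Y i ∣ < γ
    Yi-small = subst (_< γ) (+-identityʳ _)
      (exchange-< (∣ Y i ∣) (b i) (a i) γ 0 (Y-size i) (subst (_< b i) (sym (+-identityʳ _)) a<b))

    p+1≤ei : p + 1 ≤ e i
    p+1≤ei = ≤-trans (ηV-≥ (Y i) Yi-small) (Y-deficiency i)

    -- Nor can the deficit exceed one: then Y i would have room for another
    -- vertex and deficiency at least p + 2.
    bi≤ai+1 : b i ≤ a i + 1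
    bi≤ai+1 with b i ≤? a i + 1
    ... | yes bi≤ = bi≤
    ... | no bi≰ = contradiction (≤-trans (ηV-≥-suc (Y i) Yi-very-small) (≤-trans (Y-deficiency i) ei≤p+1))
                                 (m+1+n≰m (p + 1))
      where
      Yi-very-small : ∣ Y i ∣ + 1 < γ
      Yi-very-small = exchange-< (∣ Y i ∣) (b i) (a i) γ 1 (Y-size i) (≰⇒> bi≰)

    others : ℕ
    others = ∑ n (λ v → when (not (v == i)) (e' v))

    all-deficiency-at-i : (η T p x X ≡ 0) × (others ≡ 0)
    all-deficiency-at-i = squeeze (η T p x X) (e i) others (p + 1)
      (sym (trans deficiency-by-branches (cong (η T p x X +_) (trans (∑-split n i e') (cong (_+ others) e'i≡ei)))))
      p+1≤ei

    e≡0 : ∀ v → adj T x v ≡ true → v ≢ i → e v ≡ 0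
    e≡0 v xv v≢i = n≤0⇒n≡0 (subst₂ _≤_ term (proj₂ all-deficiency-at-i) (∑-term n (λ v → when (not (v == i)) (e' v)) v))
      where
      term : when (not (v == i)) (e' v) ≡ e v
      term rewrite ==-≢ v≢i | xv = refl

    x-dominated : p ≤ degIn T x X
    x-dominated = m∸n≡0⇒m≤n (trans (sym (η-outside T p x X x∉X)) (proj₁ all-deficiency-at-i))

    -- Every other branch of X completes D to a p-dominating set, hence carries
    -- at least as much as D; if exactly as much, it agrees with D there.
    Y-dominating : ∀ v → adj T x v ≡ true → v ≢ i → IsPDom T p (Y v)
    Y-dominating v xv v≢i = ηV-zero⇒pdom T p (Y v) (n≤0⇒n≡0 (subst (ηV T p (Y v) ≤_) (e≡0 v xv v≢i) (Y-deficiency v)))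

    b≤a : ∀ v → adj T x v ≡ true → v ≢ i → b v ≤ a v
    b≤a v xv v≢i = +-cancelʳ-≤ γ (b v) (a v)
      (subst₂ _≤_ (+-comm γ (b v)) (Y-size v) (+-monoˡ-≤ (b v) (γ-≤ T p γ hγ (Y v) (Y-dominating v xv v≢i))))

    agree : ∀ v → adj T x v ≡ true → v ≢ i → a v ≡ b v → ∀ w → inBranch v w ≡ true → lookup X w ≡ lookup D w
    agree v xv v≢i a≡b w hw =
      trans (sym (splice-in (inBranch v) X D w hw)) (γSet-unique (Y v) D γY γD w)
      where
      γY : IsGammaPSet T p (Y v)
      γY = γ-sized⇒γSet T p γ hγ (Y v) (Y-dominating v xv v≢i)
             (+-cancelʳ-≡ (b v) (∣ Y v ∣) γ (trans (Y-size v) (trans (cong (_+ γ) a≡b) (+-comm (b v) γ))))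

    excess : Fin n → ℕ
    excess v = when (adj T x v ∧ not (v == i)) (a v ∸ b v)

    ∑excess≤1 : ∑ n excess ≤ 1
    ∑excess≤1 = +-cancelˡ-≤ (∑ n b') (∑ n excess) 1 (begin
        ∑ n b' + ∑ n excess
      ≡⟨ ∑-+ n b' excess ⟨
        ∑ n (λ v → b' v + excess v)
      ≤⟨ ∑-mono n pointwise ⟩
        ∑ n (λ v → a' v + 𝟙 (v == i))
      ≡⟨ trans (∑-+ n a' (λ v → 𝟙 (v == i))) (cong (∑ n a' +_) (∑-𝟙-point n i)) ⟩
        ∑ n a' + 1
      ≤⟨ +-monoˡ-≤ 1 ∑a'≤∑b' ⟩
        ∑ n b' + 1
      ∎)
      where
      open ≤-Reasoning
      at : ∀ {v} → adj T x v ≡ true → Dec (v ≡ i) → b v + when (not (v == i)) (a v ∸ b v) ≤ a v + 𝟙 (v == i)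
      at xv (yes refl) rewrite ==-refl i = subst (_≤ a i + 1) (sym (+-identityʳ (b i))) bi≤ai+1
      at {v} xv (no v≢i) rewrite ==-≢ v≢i = ≤-reflexive (trans (m+[n∸m]≡n (b≤a v xv v≢i)) (sym (+-identityʳ (a v))))
      pointwise : ∀ v → b' v + excess v ≤ a' v + 𝟙 (v == i)
      pointwise v with adj T x v in xv
      ... | false = z≤n
      ... | true = at xv (v ≟ i)

    excess-pos : ∀ v → adj T x v ≡ true → v ≢ i → a v ≢ b v → 1 ≤ excess v
    excess-pos v xv v≢i a≢b rewrite xv | ==-≢ v≢i =
      m<n⇒0<n∸m (≤∧≢⇒< (b≤a v xv v≢i) (λ b≡a → a≢b (sym b≡a)))

    at-most-two : (P : Fin n → Bool) → (∀ v → P v ≡ true → v ≢ i → 1 ≤ excess v) → ∑ n (λ v → 𝟙 (P v)) ≤ 2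
    at-most-two P forces = begin
        ∑ n (λ v → 𝟙 (P v))
      ≤⟨ ∑-mono n (λ v → by-cases (P v) (λ Pv → at Pv (v ≟ i)) (λ Pv → subst (λ β → 𝟙 β ≤ _) (sym Pv) z≤n)) ⟩
        ∑ n (λ v → 𝟙 (v == i) + excess v)
      ≡⟨ trans (∑-+ n _ excess) (cong (_+ ∑ n excess) (∑-𝟙-point n i)) ⟩
        1 + ∑ n excess
      ≤⟨ +-monoʳ-≤ 1 ∑excess≤1 ⟩
        2
      ∎
      where
      open ≤-Reasoning
      at : ∀ {v} → P v ≡ true → Dec (v ≡ i) → 𝟙 (P v) ≤ 𝟙 (v == i) + excess v
      at Pv (yes refl) rewrite Pv | ==-refl i = s≤s z≤n
      at {v} Pv (no v≢i) rewrite Pv = ≤-trans (forces v Pv v≢i) (m≤n+m _ _)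

    -- A private neighbour v ≠ i of x would have a branch with positive excess:
    -- were X to agree with D there, v would miss x and be deficient for X.
    PN≤2 : ∣ PN T p x D ∣ ≤ 2
    PN≤2 = subst (_≤ 2) (sym (card-tabulate isPrivate)) (at-most-two isPrivate forces)
      where
      isPrivate : Fin n → Bool
      isPrivate v = adj T x v ∧ not (lookup D v) ∧ (degIn T v D ≡ᵇ p)
      parts : ∀ α β γ' → (α ∧ not β ∧ γ') ≡ true → (α ≡ true) × (β ≡ false) × (γ' ≡ true)
      parts true false true _ = refl , refl , refl
      forces : ∀ v → isPrivate v ≡ true → v ≢ i → 1 ≤ excess v
      forces v pv v≢i = excess-pos v xv v≢i not-agreeing
        where
        pv-parts = parts (adj T x v) (lookup D v) (degIn T v D ≡ᵇ p) pv
        xv = proj₁ pv-parts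
        v∉D = proj₁ (proj₂ pv-parts)
        degv : degIn T v D ≡ p
        degv = ≡ᵇ⇒≡ (degIn T v D) p (subst IsTrue (sym (proj₂ (proj₂ pv-parts))) _)
        not-agreeing : a v ≢ b v
        not-agreeing a≡b = contradiction (≤-trans deficient (≤-reflexive (e≡0 v xv v≢i))) λ ()
          where
          agreeing = agree v xv v≢i a≡b
          v∉X : lookup X v ≡ false
          v∉X = trans (agreeing v (inBranch-root v xv)) v∉D
          deg+1≤p : degIn T v X + 1 ≤ p
          deg+1≤p = subst (degIn T v X + 1 ≤_) degv (degIn-root-agree v X D xv agreeing x∉X x∈D)
          deficient : 1 ≤ e v
          deficient = ≤-trans
            (subst (1 ≤_) (sym (η-outside T p v X v∉X)) (m<n⇒0<n∸m (subst (_≤ p) (+-comm _ 1) deg+1≤p)))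
            (subst (λ β → when β (η T p v X) ≤ e v) (inBranch-root v xv)
                   (∑-term n (λ w → when (inBranch v w) (η T p w X)) v))

    -- As μ_p(x, D) ≥ p + 2, x has no neighbour in D.
    degxD≡0 : degIn T x D ≡ 0
    degxD≡0 = ∸-lossless p (degIn T x D) (≤-trans (s≤s z≤n) 3≤p)
      (+-cancelˡ-≤ 2 p _ (≤-trans (subst (_≤ μ T p x D) (+-comm p 2) μ≥p+2) (+-monoˡ-≤ _ PN≤2)))

    -- A neighbour t ≠ i of x in X would have a branch with positive excess:
    -- were X to agree with D there, t would be a neighbour of x in D.
    degxX≤2 : degIn T x X ≤ 2
    degxX≤2 = subst (_≤ 2) (sym (degIn-∑ T x X)) (at-most-two (λ t → adj T x t ∧ lookup X t) forces)
      where
      parts : ∀ α β → (α ∧ β) ≡ true → (α ≡ true) × (β ≡ true)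
      parts true true _ = refl , refl
      forces : ∀ t → (adj T x t ∧ lookup X t) ≡ true → t ≢ i → 1 ≤ excess t
      forces t xt∧t∈X t≢i = excess-pos t xt t≢i not-agreeing
        where
        xt = proj₁ (parts (adj T x t) (lookup X t) xt∧t∈X)
        t∈X = proj₂ (parts (adj T x t) (lookup X t) xt∧t∈X)
        not-agreeing : a t ≢ b t
        not-agreeing a≡b = contradiction (subst (1 ≤_) degxD≡0 (subst (1 ≤_) (sym (degIn-∑ T x D)) one)) λ ()
          where
          t∈D : lookup D t ≡ true
          t∈D = trans (sym (agree t xt t≢i a≡b t (inBranch-root t xt))) t∈X
          one : 1 ≤ ∑ n (λ w → 𝟙 (adj T x w ∧ lookup D w))
          one = ≤-trans (subst₂ (λ α β → 1 ≤ 𝟙 (α ∧ β)) (sym xt) (sym t∈D) ≤-refl)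
                        (∑-term n (λ w → 𝟙 (adj T x w ∧ lookup D w)) t)

    -- But η_p(x, X) = 0 forces p ≥ 3 neighbours of x into X.
    absurd : ⊥
    absurd = 3≰2 (≤-trans 3≤p (≤-trans x-dominated degxX≤2))

  no-deficit : ∀ v → adj T x v ≡ true → b v ≤ a v
  no-deficit v xv = ≮⇒≥ (λ a<b → ⊥-elim (Deficit.absurd v xv a<b))

  balanced : ∀ y → adj T x y ≡ true → a y ≡ b y
  balanced y xy = trans (sym (cong (λ β → when β (a y)) xy))
                        (trans (∑-≤-rigid n a' b' b'≤a' ∑a'≤∑b' y) (cong (λ β → when β (b y)) xy))
    where
    b'≤a' : ∀ v → b' v ≤ a' v
    b'≤a' v with adj T x v in xv
    ... | false = z≤n
    ... | true = no-deficit v xv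

-- The theorem: the component C of T - x containing y is the branch of y,
-- which is balanced.
lemma3p4 : {n : ℕ} (p : ℕ) (T : Graph n) → 3 ≤ p → IsTree T → IsRP T p (p + 1)
    → (D : Subset n) → IsGammaPSet T p D
    → (x : Fin n) → x ∈ D
    → (X : Subset n) → x ∉ X → (γ : ℕ) → IsGammaP T p γ → ∣ X ∣ < γ
    → p + 2 ≤ μ T p x D
    → ηV T p X ≡ p + 1
    → (y : Fin n) → adj T x y ≡ true
    → (C : Subset n) → IsComponentMinus T x y C
    → ∣ X ∩ C ∣ ≡ ∣ D ∩ C ∣
lemma3p4 p T 3≤p tree rp D γD x x∈D X x∉X γ hγ ∣X∣<γ μ≥p+2 ηVX≡p+1 y xy C component = begin
    ∣ X ∩ C ∣
  ≡⟨ ∣∩∣≡countIn X C (inBranch y) C≡branch ⟩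
    countIn (inBranch y) X
  ≡⟨ balanced y xy ⟩
    countIn (inBranch y) D
  ≡⟨ ∣∩∣≡countIn D C (inBranch y) C≡branch ⟨
    ∣ D ∩ C ∣
  ∎
  where
  open ≡-Reasoning
  open Main T tree p 3≤p rp D γD x ([]=⇒lookup x∈D) X (∉⇒lookup X x x∉X) γ hγ ∣X∣<γ μ≥p+2 ηVX≡p+1
  open Branches T tree x using (inBranch)
  open BranchCounting T tree x using (component≡branch)
  C≡branch : ∀ w → lookup C w ≡ inBranch y w
  C≡branch = component≡branch y C xy component
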